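{- Let $K=(AP,W,R,L,w_I)$ be a Kripke structure and let $U_K=(AP,W^\bullet,R^\bullet,L^\bullet,\varepsilon)$ be its tree-like unwinding. Then the relation $\{(x,\mathrm{pr}(x)) : x\in W^\bullet\}\subseteq W^\bullet\times W$ is a cycle-bisimulation relation between $U_K$ and $K$. Hence $K$ and $U_K$ satisfy exactly the same CTL*CD state formulas.
   Context: A Kripke structure over a finite set $AP$ is $K=(AP,W,R,L,w_I)$ with $W$ a countable non-empty set, $w_I\in W$, $R\subseteq W\times W$ left-total, $L:W\to 2^{AP}$. A path is an infinite sequence $\pi$ of worlds with $(\pi_i,\pi_{i+1})\in R$ for all $i$; it is a cycle if for every $i$ there is $j>i$ with $\pi_j=\pi_0$; $\mathrm{Pth}(w)$, $\mathrm{Cyc}(w)$ are the paths, resp. cycles, with $\pi_0=w$. CTL*CD: state formulas $\phi ::= p \mid \neg\phi\mid\phi\wedge\phi\mid\phi\vee\phi\mid \mathsf E\psi\mid\mathsf A\psi\mid \mathsf E^{\circlearrowleft}\psi\mid\mathsf A^{\circlearrowleft}\psi$, path formulas $\psi::=\phi\mid\neg\psi\mid\psi\wedge\psi\mid\psi\vee\psi\mid \mathsf X\psi\mid\psi\,\mathsf U\,\psi$; $K,w\models p$ iff $p\in L(w)$; Boolean connectives usual; $\mathsf E\psi$/$\mathsf A\psi$: some/every $\pi\in\mathrm{Pth}(w)$ has $K,\pi,0\models\psi$; $\mathsf E^{\circlearrowleft}\psi$/$\mathsf A^{\circlearrowleft}\psi$: some/every $\pi\in\mathrm{Cyc}(w)$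 has $K,\pi,0\models\psi$; $K,\pi,i\models\phi$ iff $K,\pi_i\models\phi$; $K,\pi,i\models\mathsf X\psi$ iff $K,\pi,i+1\models\psi$; $K,\pi,i\models\psi_1\mathsf U\psi_2$ iff some $k$ has $K,\pi,i+k\models\psi_2$ and $K,\pi,i+j\models\psi_1$ for all $0\le j<k$. $K\models\phi$ iff $K,w_I\models\phi$. Cycle-bisimulation relation between $K_1$ and $K_2$: $B\subseteq W_1\times W_2$ with (1) $(w_{I,1},w_{I,2})\in B$ and (2) for all $(w_1,w_2)\in B$: (a) $L_1(w_1)=L_2(w_2)$; (b) every $R_1$-successor $v_1$ of $w_1$ has an $R_2$-successor $v_2$ of $w_2$ with $(v_1,v_2)\in B$; (c) every $R_2$-successor $v_2$ of $w_2$ has an $R_1$-successor $v_1$ of $w_1$ with $(v_1,v_2)\in B$; (d) for every cycle $\pi_1$ of $K_1$ starting at $w_1$ there is a cycle $\pi_2$ of $K_2$ starting at $w_2$ with $((\pi_1)_i,(\pi_2)_i)\in B$ for all $i$; (e) symmetrically from $K_2$ to $K_1$. Tree-like unwinding: let $\mathsf{new},\mathsf{cycle}$ be two constants. The projection $\mathrm{pr}:(W\times\{\mathsf{new},\mathsf{cycle}\})^*\to W$ is given by $\mathrm{pr}(\varepsilon)=w_I$ and $\mathrm{pr}(x)=w$ when the last letter of $x\neq\varepsilon$ is $(w,\alpha)$. A sequence $x$ admits $u$ as initial cycle state if there are worlds $v_1,\dots,v_k$ with $k\ge1$ such that $x=u\,(v_1,\mathsf{new})(v_2,\mathsf{cycle})\cdots(v_k,\mathsf{cycle})$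 (each $x$ admits at most one). Define the relation $R^\bullet$ on $(W\times\{\mathsf{new},\mathsf{cycle}\})^*$: for every $x$ and every $v$ with $(\mathrm{pr}(x),v)\in R$: $(x,x(v,\mathsf{new}))\in R^\bullet$; if $x$ admits initial cycle state $u$ with $\mathrm{pr}(u)\neq v$, then $(x,x(v,\mathsf{cycle}))\in R^\bullet$; if $x$ admits initial cycle state $u$ with $\mathrm{pr}(u)=v$, then $(x,u)\in R^\bullet$ (a back edge). $W^\bullet$ is the set of sequences reachable from $\varepsilon$ via $R^\bullet$, $R^\bullet$ is restricted to $W^\bullet$, $L^\bullet(x)=L(\mathrm{pr}(x))$, and the initial world is $\varepsilon$. -}

module Defs where

open import Data.Nat using (ℕ; zero; suc; _+_; _<_)
open import Data.Fin using (Fin)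
open import Data.Bool using (Bool)
open import Data.List using (List; []; _∷_; map)
open import Data.Product using (Σ; ∃; _×_; _,_; proj₁)
open import Data.Sum using (_⊎_)
open import Data.Empty using (⊥)
open import Relation.Nullary using (¬_)
open import Relation.Binary.PropositionalEquality using (_≡_; _≢_)
open import Relation.Binary.Construct.Closure.ReflexiveTransitive using (Star)
open import Function.Definitions using (Injective)

record KS (n : ℕ) : Set₁ where
  field
    W  : Set
    R  : W → W → Set
    L  : W → (Fin n → Bool)
    wI : W

-- Side conditions of the paper's definition: W countable (an injection
-- into ℕ), non-empty (witnessed by wI), R left-total.
record IsKripke {n : ℕ} (K : KS n) : Set where
  open KS K
  field
    countable : Σ (W → ℕ) (λ f → Injective _≡_ _≡_ f)
    leftTotal : ∀ w → Σ W (λ v → R w v)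

module _ {n : ℕ} (K : KS n) where
  open KS K

  Path : Set
  Path = Σ (ℕ → W) (λ π → ∀ i → R (π i) (π (suc i)))

  IsCycle : Path → Set
  IsCycle (π , _) = ∀ i → Σ ℕ (λ j → i < j × π j ≡ π 0)

mutual
  data StateF (n : ℕ) : Set where
    atom : Fin n → StateF n
    ¬ₛ_  : StateF n → StateF n
    _∧ₛ_ _∨ₛ_ : StateF n → StateF n → StateF n
    E A Eᶜ Aᶜ : PathF n → StateF n

  data PathF (n : ℕ) : Set where
    st   : StateF n → PathF n
    ¬ₚ_  : PathF n → PathF n
    _∧ₚ_ _∨ₚ_ : PathF n → PathF n → PathF n
    X    : PathF n → PathF n
    _U_  : PathF n → PathF n → PathF n

module _ {n : ℕ} (K : KS n) where
  open KS K

  mutual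
    Sat : W → StateF n → Set
    Sat w (atom p) = L w p ≡ Data.Bool.true
    Sat w (¬ₛ φ) = ¬ Sat w φ
    Sat w (φ ∧ₛ φ′) = Sat w φ × Sat w φ′
    Sat w (φ ∨ₛ φ′) = Sat w φ ⊎ Sat w φ′
    Sat w (E ψ) = Σ (Path K) (λ π → proj₁ π 0 ≡ w × SatP π 0 ψ)
    Sat w (A ψ) = (π : Path K) → proj₁ π 0 ≡ w → SatP π 0 ψ
    Sat w (Eᶜ ψ) = Σ (Path K) (λ π → IsCycle K π × proj₁ π 0 ≡ w × SatP π 0 ψ)
    Sat w (Aᶜ ψ) = (π : Path K) → IsCycle K π → proj₁ π 0 ≡ w → SatP π 0 ψ

    SatP : Path K → ℕ → PathF n → Set
    SatP π i (st φ) = Sat (proj₁ π i) φ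
    SatP π i (¬ₚ ψ) = ¬ SatP π i ψ
    SatP π i (ψ ∧ₚ ψ′) = SatP π i ψ × SatP π i ψ′
    SatP π i (ψ ∨ₚ ψ′) = SatP π i ψ ⊎ SatP π i ψ′
    SatP π i (X ψ) = SatP π (suc i) ψ
    SatP π i (ψ U ψ′) =
      Σ ℕ (λ k → SatP π (i + k) ψ′ × (∀ j → j < k → SatP π (i + j) ψ))

  Models : StateF n → Set
  Models φ = Sat wI φ

record IsCycleBisim {n : ℕ} (K₁ K₂ : KS n)
         (B : KS.W K₁ → KS.W K₂ → Set) : Set where
  private
    module K₁ = KS K₁
    module K₂ = KS K₂
  field
    initial : B K₁.wI K₂.wI
    label   : ∀ {w₁ w₂} → B w₁ w₂ → K₁.L w₁ ≡ K₂.L w₂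
    forth   : ∀ {w₁ w₂} → B w₁ w₂ → ∀ v₁ → K₁.R w₁ v₁ →
              Σ K₂.W (λ v₂ → K₂.R w₂ v₂ × B v₁ v₂)
    back    : ∀ {w₁ w₂} → B w₁ w₂ → ∀ v₂ → K₂.R w₂ v₂ →
              Σ K₁.W (λ v₁ → K₁.R w₁ v₁ × B v₁ v₂)
    cycForth : ∀ {w₁ w₂} → B w₁ w₂ → (π₁ : Path K₁) → IsCycle K₁ π₁ →
               proj₁ π₁ 0 ≡ w₁ →
               Σ (Path K₂) (λ π₂ → IsCycle K₂ π₂ × proj₁ π₂ 0 ≡ w₂ ×
                 (∀ i → B (proj₁ π₁ i) (proj₁ π₂ i)))
    cycBack  : ∀ {w₁ w₂} → B w₁ w₂ → (π₂ : Path K₂) → IsCycle K₂ π₂ →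
               proj₁ π₂ 0 ≡ w₂ →
               Σ (Path K₁) (λ π₁ → IsCycle K₁ π₁ × proj₁ π₁ 0 ≡ w₁ ×
                 (∀ i → B (proj₁ π₁ i) (proj₁ π₂ i)))

data Tag : Set where
  new cycle : Tag

module Unwinding {n : ℕ} (K : KS n) where
  open KS K

  data Seq : Set where
    ε   : Seq
    _▸_ : Seq → W × Tag → Seq

  _▸▸_ : Seq → List (W × Tag) → Seq
  x ▸▸ [] = x
  x ▸▸ (a ∷ as) = (x ▸ a) ▸▸ as

  pr : Seq → W
  pr ε = wI
  pr (x ▸ (w , _)) = w

  AdmitsICS : Seq → Seq → Set
  AdmitsICS x u = Σ W (λ v₁ → Σ (List W) (λ vs →
    x ≡ (u ▸ (v₁ , new)) ▸▸ map (λ v → (v , cycle)) vs))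

  data R• : Seq → Seq → Set where
    toNew   : ∀ {x v} → R (pr x) v → R• x (x ▸ (v , new))
    toCycle : ∀ {x u v} → R (pr x) v → AdmitsICS x u → pr u ≢ v →
              R• x (x ▸ (v , cycle))
    backEdge : ∀ {x u v} → R (pr x) v → AdmitsICS x u → pr u ≡ v →
               R• x u

  W• : Set
  W• = Σ Seq (λ x → Star R• ε x)

  U : KS n
  U = record
    { W  = W•
    ; R  = λ x y → R• (proj₁ x) (proj₁ y)
    ; L  = λ x → L (pr (proj₁ x))
    ; wI = ε , Star.ε
    }

  Bpr : W• → W → Set
  Bpr x w = pr (proj₁ x) ≡ w

-- A cycle-bisimulation transfers every CTL*CD formula: E and A are handled by
-- lifting paths step by step along the forth condition (of the relation or of
-- its converse), Eᶜ and Aᶜ directly by the cycle conditions, and negation by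
-- passing to the converse relation. For the unwinding, pr maps R•-edges to
-- R-edges, which gives forth and projects cycles of U to cycles of K; back is
-- a new-edge. The only real work is lifting a cycle π of K from a node x₀:
-- leave x₀ by a new-edge, follow π by cycle-edges, and take the back edge to
-- x₀ whenever π returns to pr x₀. Since π returns infinitely often, so does
-- its lift.
module Submission where

open import Defs
open import Data.Nat using (ℕ; zero; suc; _+_; _≤_; s≤s)
open import Data.Nat.Properties using (eq?; ≤-refl; n≤1+n; <-≤-trans)
open import Data.List using ([]; _∷_; map; _++_; [_])
open import Data.List.Properties using (map-++)
open import Data.Product using (Σ; _×_; _,_; proj₁; proj₂)
open import Data.Sum using (_⊎_; inj₁; inj₂)
open import Function using (flip)
open import Function.Bundles using (_⇔_; mk⇔; mk↣)
open import Relation.Binary.Definitions using (DecidableEquality)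
open import Relation.Binary.Construct.Closure.ReflexiveTransitive using (Star; _◅◅_; _◅_)
open import Relation.Binary.PropositionalEquality
  using (_≡_; refl; sym; trans; subst; cong; cong-app; module ≡-Reasoning)
open import Relation.Nullary using (Dec; yes; no; contradiction)

module _ {n : ℕ} {K₁ K₂ : KS n} where
  private
    module K₁ = KS K₁
    module K₂ = KS K₂

  flipCycleBisim : ∀ {B} → IsCycleBisim K₁ K₂ B → IsCycleBisim K₂ K₁ (flip B)
  flipCycleBisim bis = record
    { initial  = initial
    ; label    = λ b → sym (label b)
    ; forth    = back
    ; back     = forth
    ; cycForth = cycBack
    ; cycBack  = cycForth
    }
    where open IsCycleBisim bis

  liftPath : ∀ {B} → IsCycleBisim K₁ K₂ B →
             (π₁ : Path K₁) {w₂ : K₂.W} → B (proj₁ π₁ 0) w₂ →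
             Σ (Path K₂) (λ π₂ → proj₁ π₂ 0 ≡ w₂ × (∀ i → B (proj₁ π₁ i) (proj₁ π₂ i)))
  liftPath {B} bis (π , edge) {w₂} b =
    ((λ i → proj₁ (lift i)) , (λ i → proj₁ (proj₂ (next i)))) , refl , (λ i → proj₂ (lift i))
    where
    mutual
      lift : ∀ i → Σ K₂.W (B (π i))
      lift zero    = w₂ , b
      lift (suc i) = proj₁ (next i) , proj₂ (proj₂ (next i))

      next : ∀ i → Σ K₂.W (λ v → K₂.R (proj₁ (lift i)) v × B (π (suc i)) v)
      next i = IsCycleBisim.forth bis (proj₂ (lift i)) (π (suc i)) (edge i)

  module PathMorphism (h : K₁.W → K₂.W) (hom : ∀ {x y} → K₁.R x y → K₂.R (h x) (h y)) where

    mapPath : Path K₁ → Path K₂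
    mapPath (π , edge) = (λ i → h (π i)) , (λ i → hom (edge i))

    mapPath-isCycle : ∀ π → IsCycle K₁ π → IsCycle K₂ (mapPath π)
    mapPath-isCycle π isCycle i =
      let (j , i<j , returns) = isCycle i in j , i<j , cong h returns

mutual
  satTransfer : ∀ {n} {K₁ K₂ : KS n} {B} → IsCycleBisim K₁ K₂ B →
                ∀ {w₁ w₂} → B w₁ w₂ → (φ : StateF n) → Sat K₁ w₁ φ → Sat K₂ w₂ φ
  satTransfer bis b (atom p) s = trans (sym (cong-app (IsCycleBisim.label bis b) p)) s
  satTransfer bis b (¬ₛ φ) ¬s s = ¬s (satTransfer (flipCycleBisim bis) b φ s)
  satTransfer bis b (φ ∧ₛ φ′) (s , s′) = satTransfer bis b φ s , satTransfer bis b φ′ s′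
  satTransfer bis b (φ ∨ₛ φ′) (inj₁ s) = inj₁ (satTransfer bis b φ s)
  satTransfer bis b (φ ∨ₛ φ′) (inj₂ s) = inj₂ (satTransfer bis b φ′ s)
  satTransfer bis b (E ψ) (π₁ , refl , s) =
    let (π₂ , start , related) = liftPath bis π₁ b
    in π₂ , start , satPTransfer bis π₁ π₂ related 0 ψ s
  satTransfer bis b (A ψ) h π₂ refl =
    let (π₁ , start , related) = liftPath (flipCycleBisim bis) π₂ b
    in satPTransfer bis π₁ π₂ related 0 ψ (h π₁ start)
  satTransfer bis b (Eᶜ ψ) (π₁ , isCycle , start , s) =
    let (π₂ , isCycle′ , start′ , related) = IsCycleBisim.cycForth bis b π₁ isCycle start
    in π₂ , isCycle′ , start′ , satPTransfer bis π₁ π₂ related 0 ψ s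
  satTransfer bis b (Aᶜ ψ) h π₂ isCycle start =
    let (π₁ , isCycle′ , start′ , related) = IsCycleBisim.cycBack bis b π₂ isCycle start
    in satPTransfer bis π₁ π₂ related 0 ψ (h π₁ isCycle′ start′)

  satPTransfer : ∀ {n} {K₁ K₂ : KS n} {B} → IsCycleBisim K₁ K₂ B →
                 (π₁ : Path K₁) (π₂ : Path K₂) → (∀ i → B (proj₁ π₁ i) (proj₁ π₂ i)) →
                 ∀ i (ψ : PathF n) → SatP K₁ π₁ i ψ → SatP K₂ π₂ i ψ
  satPTransfer bis π₁ π₂ related i (st φ) s = satTransfer bis (related i) φ s
  satPTransfer bis π₁ π₂ related i (¬ₚ ψ) ¬s s =
    ¬s (satPTransfer (flipCycleBisim bis) π₂ π₁ related i ψ s)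
  satPTransfer bis π₁ π₂ related i (ψ ∧ₚ ψ′) (s , s′) =
    satPTransfer bis π₁ π₂ related i ψ s , satPTransfer bis π₁ π₂ related i ψ′ s′
  satPTransfer bis π₁ π₂ related i (ψ ∨ₚ ψ′) (inj₁ s) = inj₁ (satPTransfer bis π₁ π₂ related i ψ s)
  satPTransfer bis π₁ π₂ related i (ψ ∨ₚ ψ′) (inj₂ s) = inj₂ (satPTransfer bis π₁ π₂ related i ψ′ s)
  satPTransfer bis π₁ π₂ related i (X ψ) s = satPTransfer bis π₁ π₂ related (suc i) ψ s
  satPTransfer bis π₁ π₂ related i (ψ U ψ′) (k , s′ , s) =
    k , satPTransfer bis π₁ π₂ related (i + k) ψ′ s′ ,
    λ j j<k → satPTransfer bis π₁ π₂ related (i + j) ψ (s j j<k)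

cycleBisim-preservesSat : ∀ {n} {K₁ K₂ : KS n} {B} → IsCycleBisim K₁ K₂ B →
                          ∀ {w₁ w₂} → B w₁ w₂ → (φ : StateF n) → Sat K₁ w₁ φ ⇔ Sat K₂ w₂ φ
cycleBisim-preservesSat bis b φ =
  mk⇔ (satTransfer bis b φ) (satTransfer (flipCycleBisim bis) b φ)

module UnwindingProperties {n : ℕ} (K : KS n) where
  open KS K
  open Unwinding K renaming (U to Uᴷ)

  ▸▸-∷ʳ : ∀ x as a → (x ▸▸ as) ▸ a ≡ x ▸▸ (as ++ [ a ])
  ▸▸-∷ʳ x []       a = refl
  ▸▸-∷ʳ x (b ∷ as) a = ▸▸-∷ʳ (x ▸ b) as a

  admitsICS-▸cycle : ∀ {x u} v → AdmitsICS x u → AdmitsICS (x ▸ (v , cycle)) u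
  admitsICS-▸cycle {u = u} v (v₁ , vs , refl) = v₁ , vs ++ [ v ] , (begin
      ((u ▸ (v₁ , new)) ▸▸ map tagCycle vs) ▸ (v , cycle)
    ≡⟨ ▸▸-∷ʳ _ (map tagCycle vs) _ ⟩
      (u ▸ (v₁ , new)) ▸▸ (map tagCycle vs ++ [ (v , cycle) ])
    ≡⟨ cong (_ ▸▸_) (sym (map-++ tagCycle vs [ v ])) ⟩
      (u ▸ (v₁ , new)) ▸▸ map tagCycle (vs ++ [ v ])
    ∎)
    where
    open ≡-Reasoning
    tagCycle : W → W × Tag
    tagCycle w = w , cycle

  pr• : W• → W
  pr• x = pr (proj₁ x)

  pr-R• : ∀ {x y} → R• x y → R (pr x) (pr y)
  pr-R• (toNew r)            = r
  pr-R• (toCycle r _ _)      = r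
  pr-R• (backEdge r _ refl)  = r

  open PathMorphism {K₁ = Uᴷ} {K₂ = K} pr• pr-R•

  extend : (x : W•) {y : Seq} → R• (proj₁ x) y → W•
  extend (x , reachable) {y} r = y , reachable ◅◅ (r ◅ Star.ε)

  module CycleLift (_≟_ : DecidableEquality W) (x₀ : W•)
                   (π : Path K) (isCycle : IsCycle K π) (start : pr• x₀ ≡ proj₁ π 0) where

    data Position (i : ℕ) : Set where
      atRoot  : pr• x₀ ≡ proj₁ π i → Position i
      onCycle : (y : W•) → AdmitsICS (proj₁ y) (proj₁ x₀) → pr• y ≡ proj₁ π i → Position i

    world : ∀ {i} → Position i → W•
    world (atRoot _)      = x₀
    world (onCycle y _ _) = y

    world-pr : ∀ {i} (p : Position i) → pr• (world p) ≡ proj₁ π i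
    world-pr (atRoot e)      = e
    world-pr (onCycle _ _ e) = e

    edgeFrom : ∀ {i} (p : Position i) → R (pr• (world p)) (proj₁ π (suc i))
    edgeFrom {i} p = subst (λ w → R w (proj₁ π (suc i))) (sym (world-pr p)) (proj₂ π i)

    Step : ∀ {i} → Position i → Set
    Step {i} p = Σ (Position (suc i)) (λ q → R• (proj₁ (world p)) (proj₁ (world q)))

    stepOnCycle : ∀ {i} y adm e → Dec (proj₁ π (suc i) ≡ pr• x₀) → Step (onCycle {i} y adm e)
    stepOnCycle y adm e (yes returns) =
      atRoot (sym returns) , backEdge (edgeFrom (onCycle y adm e)) adm (sym returns)
    stepOnCycle y adm e (no ¬returns) =
      onCycle (extend y r) (admitsICS-▸cycle _ adm) refl , r
      where r = toCycle (edgeFrom (onCycle y adm e)) adm (λ eq → ¬returns (sym eq))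

    step : ∀ {i} (p : Position i) → Step p
    step {i} (atRoot e) = onCycle (extend x₀ r) (proj₁ π (suc i) , [] , refl) refl , r
      where r = toNew (edgeFrom (atRoot e))
    step {i} (onCycle y adm e) = stepOnCycle y adm e (proj₁ π (suc i) ≟ pr• x₀)

    position : ∀ i → Position i
    position zero    = atRoot start
    position (suc i) = proj₁ (step (position i))

    lifted : Path Uᴷ
    lifted = (λ i → world (position i)) , (λ i → proj₂ (step (position i)))

    stepOnCycle-returnsToRoot : ∀ {i} y adm e d → proj₁ π (suc i) ≡ pr• x₀ →
                          world (proj₁ (stepOnCycle {i} y adm e d)) ≡ x₀
    stepOnCycle-returnsToRoot y adm e (yes _)       _       = refl
    stepOnCycle-returnsToRoot y adm e (no ¬returns) returns = contradiction returns ¬returns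

    -- From x₀ the lift always leaves along a new-edge, so a return of π to
    -- pr x₀ brings the lift to x₀ either at that step or one step earlier.
    returnsToRoot : ∀ {i} → proj₁ π (suc i) ≡ pr• x₀ → (p : Position i) →
              world p ≡ x₀ ⊎ world (proj₁ (step p)) ≡ x₀
    returnsToRoot _       (atRoot _)        = inj₁ refl
    returnsToRoot {i} ret (onCycle y adm e) =
      inj₂ (stepOnCycle-returnsToRoot y adm e (proj₁ π (suc i) ≟ pr• x₀) ret)

    revisits : ∀ m → proj₁ π (suc m) ≡ proj₁ π 0 → Σ ℕ (λ k → m ≤ k × world (position k) ≡ x₀)
    revisits m ret with returnsToRoot (trans ret (sym start)) (position m)
    ... | inj₁ atM    = m , ≤-refl , atM
    ... | inj₂ atSucM = suc m , n≤1+n m , atSucM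

    lifted-isCycle : IsCycle Uᴷ lifted
    lifted-isCycle i with isCycle (suc i)
    ... | suc m , s≤s i<m , ret =
      let (k , m≤k , atX₀) = revisits m ret in k , <-≤-trans i<m m≤k , atX₀

  unwinding-isCycleBisim : DecidableEquality W → IsCycleBisim Uᴷ K Bpr
  unwinding-isCycleBisim _≟_ = record
    { initial  = refl
    ; label    = cong L
    ; forth    = λ { refl y r → pr• y , pr-R• r , refl }
    ; back     = λ { {x} refl v r → extend x (toNew r) , toNew r , refl }
    ; cycForth = λ { refl π isCycle refl →
        mapPath π , mapPath-isCycle π isCycle , refl , (λ _ → refl) }
    ; cycBack  = λ { {x} refl π isCycle start → let open CycleLift _≟_ x π isCycle (sym start) in
        lifted , lifted-isCycle , refl , (λ i → world-pr (position i)) }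
    }

mainTheorem4 : {n : ℕ} (K : KS n) → IsKripke K →
    IsCycleBisim (Unwinding.U K) K (Unwinding.Bpr K) ×
    ((φ : StateF n) → Models K φ ⇔ Models (Unwinding.U K) φ)
mainTheorem4 K isKripke = bisim , cycleBisim-preservesSat (flipCycleBisim bisim) refl
  where
  -- Countability is needed only to decide, while lifting a cycle, whether
  -- to take a cycle-edge or the back edge.
  decEq : DecidableEquality (KS.W K)
  decEq = eq? (mk↣ (proj₂ (IsKripke.countable isKripke)))

  bisim : IsCycleBisim (Unwinding.U K) K (Unwinding.Bpr K)
  bisim = UnwindingProperties.unwinding-isCycleBisim K decEq
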